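{- Let $G$ be a graph such that for every $\gamma_R$-function $f=(V_0,V_1,V_2)$ of $G$, the induced subgraph $G[V_2]$ has an isolated vertex. Then $\gamma_R(\mu(G))=\gamma_R(G)+2$.
   Context: All graphs are finite and simple. A Roman dominating function (RDF) of $G=(V,E)$ is a function $f:V\to\{0,1,2\}$ such that every vertex $v$ with $f(v)=0$ has a neighbor $w$ with $f(w)=2$; its weight is $\sum_v f(v)$, $\gamma_R(G)$ is the minimum weight of an RDF, and a $\gamma_R$-function is an RDF of weight $\gamma_R(G)$. Write $f=(V_0,V_1,V_2)$ with $V_i=\{v:f(v)=i\}$. The Mycielskian $\mu(G)$ of $G$ with $V(G)=\{v_1^0,\ldots,v_n^0\}$ has vertex set $\{v_j^0\}\cup\{v_j^1\}\cup\{u\}$ and edge set $E(G)\cup\{v_j^0v_{j'}^1 : v_j^0v_{j'}^0\in E(G)\}\cup\{v_j^1u: 1\leq j\leq n\}$. -}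

module Defs where

open import Data.Nat using (ℕ; zero; suc; _+_; _≤_)
open import Data.Fin using (Fin; zero; suc; splitAt; join)
open import Data.Bool using (Bool; true; false; T)
open import Data.Sum using (_⊎_; inj₁; inj₂)
open import Data.Product using (Σ; ∃; _×_; _,_)
open import Data.Empty using (⊥)
open import Relation.Nullary using (¬_)
open import Relation.Binary.PropositionalEquality using (_≡_)

record Graph : Set where
  field
    n     : ℕ
    adj   : Fin n → Fin n → Bool
    sym   : ∀ x y → adj x y ≡ adj y x
    irref : ∀ x → adj x x ≡ false
open Graph public

data R3 : Set where
  r0 r1 r2 : R3

val : R3 → ℕ
val r0 = 0
val r1 = 1
val r2 = 2

sumFin : (n : ℕ) → (Fin n → ℕ) → ℕ
sumFin zero    g = 0
sumFin (suc n) g = g zero + sumFin n (λ i → g (suc i))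

weight : (G : Graph) → (Fin (n G) → R3) → ℕ
weight G f = sumFin (n G) (λ v → val (f v))

IsRDF : (G : Graph) → (Fin (n G) → R3) → Set
IsRDF G f = ∀ v → f v ≡ r0 → ∃ λ w → T (adj G v w) × f w ≡ r2

IsγR : Graph → ℕ → Set
IsγR G k = (∃ λ f → IsRDF G f × weight G f ≡ k)
         × (∀ f → IsRDF G f → k ≤ weight G f)

IsγRFun : (G : Graph) → (Fin (n G) → R3) → Set
IsγRFun G f = IsRDF G f × (∀ g → IsRDF G g → weight G f ≤ weight G g)

V2HasIsolated : (G : Graph) → (Fin (n G) → R3) → Set
V2HasIsolated G f = ∃ λ v → f v ≡ r2 × (∀ w → f w ≡ r2 → adj G v w ≡ false)

-- Mycielskian. Vertices of μ(G): Fin (n + (n + 1)):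
--   join-left  i        = v_i^0
--   join-right (inl i)  = v_i^1
--   join-right (inr 0)  = u
data MV (n : ℕ) : Set where
  old  : Fin n → MV n
  copy : Fin n → MV n
  hub  : MV n

view : (n : ℕ) → Fin (n + (n + 1)) → MV n
view n x with splitAt n x
... | inj₁ i = old i
... | inj₂ y with splitAt n y
...   | inj₁ j = copy j
...   | inj₂ _ = hub

μadjV : (G : Graph) → MV (n G) → MV (n G) → Bool
μadjV G (old i)  (old j)  = adj G i j
μadjV G (old i)  (copy j) = adj G i j
μadjV G (copy i) (old j)  = adj G i j
μadjV G (copy i) (copy j) = false
μadjV G (copy i) hub      = true
μadjV G hub      (copy j) = true
μadjV G (old i)  hub      = false
μadjV G hub      (old j)  = false
μadjV G hub      hub      = false

μadj : (G : Graph) → Fin (n G + (n G + 1)) → Fin (n G + (n G + 1)) → Bool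
μadj G x y = μadjV G (view (n G) x) (view (n G) y)

private
  μsymV : (G : Graph) → ∀ a b → μadjV G a b ≡ μadjV G b a
  μsymV G (old i)  (old j)  = sym G i j
  μsymV G (old i)  (copy j) = sym G i j
  μsymV G (copy i) (old j)  = sym G i j
  μsymV G (copy i) (copy j) = Relation.Binary.PropositionalEquality.refl
  μsymV G (copy i) hub      = Relation.Binary.PropositionalEquality.refl
  μsymV G hub      (copy j) = Relation.Binary.PropositionalEquality.refl
  μsymV G (old i)  hub      = Relation.Binary.PropositionalEquality.refl
  μsymV G hub      (old j)  = Relation.Binary.PropositionalEquality.refl
  μsymV G hub      hub      = Relation.Binary.PropositionalEquality.refl

  μirrV : (G : Graph) → ∀ a → μadjV G a a ≡ false
  μirrV G (old i)  = irref G i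
  μirrV G (copy i) = Relation.Binary.PropositionalEquality.refl
  μirrV G hub      = Relation.Binary.PropositionalEquality.refl

μ : Graph → Graph
μ G = record
  { n     = n G + (n G + 1)
  ; adj   = μadj G
  ; sym   = λ x y → μsymV G (view (n G) x) (view (n G) y)
  ; irref = λ x → μirrV G (view (n G) x)
  }

-- Extending an RDF of G by 2 on the hub u gives γ_R(μ(G)) ≤ γ_R(G) + 2.  Conversely, an RDF h
-- of μ(G) folds onto G by giving v_i the larger of the labels of v_i^0 and v_i^1; this loses no
-- domination and costs at most the weight of the copies.  If h(u) = 2 this already suffices.
-- If h(u) = 0, some copy v_a^1 carries 2, and keeping only h(v_a^0) at a saves 2 more.  If
-- h(u) = 1 and the fold were a γ_R-function, its isolated 2-vertex a would have both v_a^0 and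
-- v_a^1 labelled nonzero (a zero there would need a 2-neighbour, which folds to a 2-neighbour
-- of a), so the fold would save at least 1: contradiction.
module Submission where

open import Defs hiding (sym)
open import Data.Bool using (T)
open import Data.Fin using (Fin; zero; suc; _↑ˡ_; _↑ʳ_; splitAt; _≟_)
open import Data.Fin.Properties using (splitAt-↑ˡ; splitAt-↑ʳ; splitAt⁻¹-↑ˡ; splitAt⁻¹-↑ʳ)
open import Data.Nat using (ℕ; zero; suc; _+_; _≤_; _<_; z≤n; s≤s)
open import Data.Nat.Properties
  using (≤-refl; ≤-trans; ≤-reflexive; +-mono-≤; +-monoˡ-≤; +-monoʳ-≤; +-assoc; +-comm; +-identityʳ; +-suc;
         m≤m+n; ≰⇒>; 1+n≰n; +-commutativeSemigroup; module ≤-Reasoning)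
open import Algebra.Properties.CommutativeSemigroup +-commutativeSemigroup using (interchange; x∙yz≈y∙xz)
open import Data.Product using (∃; _×_; _,_; proj₁; proj₂)
open import Data.Sum using (_⊎_; inj₁; inj₂)
open import Function using (_∘_)
open import Relation.Nullary using (yes; no; contradiction)
open import Relation.Binary.PropositionalEquality
  using (_≡_; _≢_; refl; sym; trans; cong; cong₂; subst; module ≡-Reasoning)

embed : (n : ℕ) → MV n → Fin (n + (n + 1))
embed n (old i)  = i ↑ˡ (n + 1)
embed n (copy j) = n ↑ʳ (j ↑ˡ 1)
embed n hub      = n ↑ʳ (n ↑ʳ zero)

view-embed : ∀ n m → view n (embed n m) ≡ m
view-embed n (old i)  rewrite splitAt-↑ˡ n i (n + 1) = refl
view-embed n (copy j) rewrite splitAt-↑ʳ n (n + 1) (j ↑ˡ 1) | splitAt-↑ˡ n j 1 = refl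
view-embed n hub      rewrite splitAt-↑ʳ n (n + 1) (n ↑ʳ zero) | splitAt-↑ʳ n 1 (zero {0}) = refl

embed-view : ∀ n x → embed n (view n x) ≡ x
embed-view n x with splitAt n x in eq
... | inj₁ i = splitAt⁻¹-↑ˡ eq
... | inj₂ y with splitAt n y in eq′
...   | inj₁ j = trans (cong (n ↑ʳ_) (splitAt⁻¹-↑ˡ eq′)) (splitAt⁻¹-↑ʳ eq)
...   | inj₂ zero = trans (cong (n ↑ʳ_) (splitAt⁻¹-↑ʳ eq′)) (splitAt⁻¹-↑ʳ eq)

sumFin-cong : ∀ n {p q : Fin n → ℕ} → (∀ i → p i ≡ q i) → sumFin n p ≡ sumFin n q
sumFin-cong zero    p≡q = refl
sumFin-cong (suc n) p≡q = cong₂ _+_ (p≡q zero) (sumFin-cong n (p≡q ∘ suc))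

sumFin-mono : ∀ n {p q : Fin n → ℕ} → (∀ i → p i ≤ q i) → sumFin n p ≤ sumFin n q
sumFin-mono zero    p≤q = z≤n
sumFin-mono (suc n) p≤q = +-mono-≤ (p≤q zero) (sumFin-mono n (p≤q ∘ suc))

sumFin-mono-gap : ∀ n e {p q : Fin n → ℕ} → (∀ i → p i ≤ q i) →
                  (a : Fin n) → e + p a ≤ q a → e + sumFin n p ≤ sumFin n q
sumFin-mono-gap (suc n) e {p} {q} p≤q zero gap = begin
  e + (p zero + sumFin n (p ∘ suc)) ≡⟨ +-assoc e (p zero) _ ⟨
  e + p zero + sumFin n (p ∘ suc)   ≤⟨ +-mono-≤ gap (sumFin-mono n (p≤q ∘ suc)) ⟩
  sumFin (suc n) q                  ∎
  where open ≤-Reasoning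
sumFin-mono-gap (suc n) e {p} {q} p≤q (suc a) gap = begin
  e + (p zero + sumFin n (p ∘ suc)) ≡⟨ x∙yz≈y∙xz e (p zero) _ ⟩
  p zero + (e + sumFin n (p ∘ suc)) ≤⟨ +-mono-≤ (p≤q zero) (sumFin-mono-gap n e (p≤q ∘ suc) a gap) ⟩
  sumFin (suc n) q                  ∎
  where open ≤-Reasoning

sumFin-++ : ∀ m k (p : Fin (m + k) → ℕ) →
            sumFin (m + k) p ≡ sumFin m (p ∘ (_↑ˡ k)) + sumFin k (p ∘ (m ↑ʳ_))
sumFin-++ zero    k p = refl
sumFin-++ (suc m) k p = trans (cong (p zero +_) (sumFin-++ m k (p ∘ suc))) (sym (+-assoc (p zero) _ _))

sumFin-+ : ∀ n (p q : Fin n → ℕ) → sumFin n (λ i → p i + q i) ≡ sumFin n p + sumFin n q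
sumFin-+ zero    p q = refl
sumFin-+ (suc n) p q =
  trans (cong (p zero + q zero +_) (sumFin-+ n (p ∘ suc) (q ∘ suc))) (interchange (p zero) (q zero) _ _)

adjacent⇒≢ : (G : Graph) {i j : Fin (n G)} → T (adj G i j) → i ≢ j
adjacent⇒≢ G {i} i~j refl = subst T (irref G i) i~j

_⊔ᴿ_ : R3 → R3 → R3
r0 ⊔ᴿ y  = y
r1 ⊔ᴿ r0 = r1
r1 ⊔ᴿ r1 = r1
r1 ⊔ᴿ r2 = r2
r2 ⊔ᴿ y  = r2

⊔ᴿ≡r0 : ∀ x y → x ⊔ᴿ y ≡ r0 → x ≡ r0 × y ≡ r0
⊔ᴿ≡r0 r0 r0 refl = refl , refl
⊔ᴿ≡r0 r1 r0 ()
⊔ᴿ≡r0 r1 r1 ()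
⊔ᴿ≡r0 r1 r2 ()
⊔ᴿ≡r0 r2 y  ()

⊔ᴿ≡r2 : ∀ x y → x ≡ r2 ⊎ y ≡ r2 → x ⊔ᴿ y ≡ r2
⊔ᴿ≡r2 r2 y  (inj₁ refl) = refl
⊔ᴿ≡r2 r0 r2 (inj₂ refl) = refl
⊔ᴿ≡r2 r1 r2 (inj₂ refl) = refl
⊔ᴿ≡r2 r2 r2 (inj₂ refl) = refl

val-⊔ᴿ≤ : ∀ x y → val (x ⊔ᴿ y) ≤ val x + val y
val-⊔ᴿ≤ r0 y  = ≤-refl
val-⊔ᴿ≤ r1 r0 = ≤-refl
val-⊔ᴿ≤ r1 r1 = s≤s z≤n
val-⊔ᴿ≤ r1 r2 = s≤s (s≤s z≤n)
val-⊔ᴿ≤ r2 r0 = ≤-refl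
val-⊔ᴿ≤ r2 r1 = s≤s (s≤s z≤n)
val-⊔ᴿ≤ r2 r2 = s≤s (s≤s z≤n)

val-⊔ᴿ< : ∀ {x y} → x ≢ r0 → y ≢ r0 → val (x ⊔ᴿ y) < val x + val y
val-⊔ᴿ< {r0}      x≢r0 _    = contradiction refl x≢r0
val-⊔ᴿ< {r1} {r0} _    y≢r0 = contradiction refl y≢r0
val-⊔ᴿ< {r2} {r0} _    y≢r0 = contradiction refl y≢r0
val-⊔ᴿ< {r1} {r1} _    _    = s≤s (s≤s z≤n)
val-⊔ᴿ< {r1} {r2} _    _    = s≤s (s≤s (s≤s z≤n))
val-⊔ᴿ< {r2} {r1} _    _    = s≤s (s≤s (s≤s z≤n))
val-⊔ᴿ< {r2} {r2} _    _    = s≤s (s≤s (s≤s z≤n))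

module _ (G : Graph) where
  private
    N : ℕ
    N = n G

  IsRDFᴹ : (MV N → R3) → Set
  IsRDFᴹ h = ∀ m → h m ≡ r0 → ∃ λ m′ → T (μadjV G m m′) × h m′ ≡ r2

  weight⁰¹ : (MV N → R3) → ℕ
  weight⁰¹ h = sumFin N (λ i → val (h (old i)) + val (h (copy i)))

  weightᴹ : (MV N → R3) → ℕ
  weightᴹ h = weight⁰¹ h + val (h hub)

  weightᴹ-cong : ∀ {h h′} → (∀ m → h m ≡ h′ m) → weightᴹ h ≡ weightᴹ h′
  weightᴹ-cong h≡h′ =
    cong₂ _+_ (sumFin-cong N λ i → cong₂ _+_ (cong val (h≡h′ (old i))) (cong val (h≡h′ (copy i))))
              (cong val (h≡h′ hub))

  weight-μ : ∀ g → weight (μ G) g ≡ weightᴹ (g ∘ embed N)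
  weight-μ g = begin
    weight (μ G) g                                        ≡⟨ sumFin-++ N (N + 1) _ ⟩
    weight⁰ + sumFin (N + 1) (λ j → val (g (N ↑ʳ j)))     ≡⟨ cong (weight⁰ +_) (sumFin-++ N 1 _) ⟩
    weight⁰ + (weight¹ + (val (g (embed N hub)) + 0))     ≡⟨ cong (λ t → weight⁰ + (weight¹ + t)) (+-identityʳ _) ⟩
    weight⁰ + (weight¹ + val (g (embed N hub)))           ≡⟨ +-assoc weight⁰ weight¹ _ ⟨
    weight⁰ + weight¹ + val (g (embed N hub))             ≡⟨ cong (_+ val (g (embed N hub))) (sumFin-+ N _ _) ⟨
    weightᴹ (g ∘ embed N)                                 ∎
    where
    open ≡-Reasoning
    weight⁰ weight¹ : ℕ
    weight⁰ = sumFin N (λ i → val (g (embed N (old i))))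
    weight¹ = sumFin N (λ i → val (g (embed N (copy i))))

  weight-view : ∀ h → weight (μ G) (h ∘ view N) ≡ weightᴹ h
  weight-view h = trans (weight-μ (h ∘ view N)) (weightᴹ-cong (cong h ∘ view-embed N))

  isRDF-view : ∀ {h} → IsRDFᴹ h → IsRDF (μ G) (h ∘ view N)
  isRDF-view {h} h-rdf x x↦r0 with h-rdf (view N x) x↦r0
  ... | m′ , x~m′ , m′↦r2 =
    embed N m′ , subst (T ∘ μadjV G (view N x)) (sym (view-embed N m′)) x~m′ ,
    trans (cong h (view-embed N m′)) m′↦r2

  isRDF-embed : ∀ {g} → IsRDF (μ G) g → IsRDFᴹ (g ∘ embed N)
  isRDF-embed {g} g-rdf m m↦r0 with g-rdf (embed N m) m↦r0
  ... | y , m~y , y↦r2 =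
    view N y , subst (λ m″ → T (μadjV G m″ (view N y))) (view-embed N m) m~y ,
    trans (cong g (embed-view N y)) y↦r2

  extend : (Fin N → R3) → MV N → R3
  extend f (old i)  = f i
  extend f (copy i) = r0
  extend f hub      = r2

  extend-isRDF : ∀ {f} → IsRDF G f → IsRDFᴹ (extend f)
  extend-isRDF f-rdf (old i) i↦r0 with f-rdf i i↦r0
  ... | j , i~j , j↦r2 = old j , i~j , j↦r2
  extend-isRDF f-rdf (copy i) _ = hub , _ , refl

  weightᴹ-extend : ∀ f → weightᴹ (extend f) ≡ weight G f + 2
  weightᴹ-extend f = cong (_+ 2) (sumFin-cong N λ i → +-identityʳ (val (f i)))

  module _ {h : MV N → R3} (h-rdf : IsRDFᴹ h) where

    fold : Fin N → R3
    fold i = h (old i) ⊔ᴿ h (copy i)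

    old-dominated : ∀ {i} → h (old i) ≡ r0 → ∃ λ j → T (adj G i j) × fold j ≡ r2
    old-dominated {i} i↦r0 with h-rdf (old i) i↦r0
    ... | old j  , i~j , j↦r2 = j , i~j , ⊔ᴿ≡r2 _ _ (inj₁ j↦r2)
    ... | copy j , i~j , j↦r2 = j , i~j , ⊔ᴿ≡r2 _ _ (inj₂ j↦r2)

    copy-dominated : h hub ≢ r2 → ∀ {i} → h (copy i) ≡ r0 → ∃ λ j → T (adj G i j) × h (old j) ≡ r2
    copy-dominated hub≢r2 {i} i↦r0 with h-rdf (copy i) i↦r0
    ... | old j , i~j , j↦r2 = j , i~j , j↦r2
    ... | hub   , _   , hub↦r2 = contradiction hub↦r2 hub≢r2

    fold-isRDF : IsRDF G fold
    fold-isRDF i i↦r0 = old-dominated (proj₁ (⊔ᴿ≡r0 _ _ i↦r0))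

    weight-fold≤ : weight G fold ≤ weight⁰¹ h
    weight-fold≤ = sumFin-mono N λ i → val-⊔ᴿ≤ (h (old i)) (h (copy i))

    weight-fold< : ∀ a → h (old a) ≢ r0 → h (copy a) ≢ r0 → weight G fold < weight⁰¹ h
    weight-fold< a old≢r0 copy≢r0 =
      sumFin-mono-gap N 1 (λ i → val-⊔ᴿ≤ (h (old i)) (h (copy i))) a (val-⊔ᴿ< old≢r0 copy≢r0)

    foldExcept : Fin N → Fin N → R3
    foldExcept a i with i ≟ a
    ... | yes _ = h (old i)
    ... | no _  = fold i

    foldExcept-self : ∀ a → foldExcept a a ≡ h (old a)
    foldExcept-self a with a ≟ a
    ... | yes _   = refl
    ... | no a≢a = contradiction refl a≢a

    foldExcept-other : ∀ a {i} → i ≢ a → foldExcept a i ≡ fold i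
    foldExcept-other a {i} i≢a with i ≟ a
    ... | yes i≡a = contradiction i≡a i≢a
    ... | no _    = refl

    foldExcept-r2 : ∀ a {i} → h (old i) ≡ r2 → foldExcept a i ≡ r2
    foldExcept-r2 a {i} i↦r2 with i ≟ a
    ... | yes _ = i↦r2
    ... | no _  = ⊔ᴿ≡r2 _ _ (inj₁ i↦r2)

    -- Away from a, a vertex folding to 0 has its copy dominated by an old 2, the hub being 0.
    foldExcept-isRDF : h hub ≡ r0 → ∀ a → IsRDF G (foldExcept a)
    foldExcept-isRDF hub↦r0 a i i↦r0 with i ≟ a
    ... | no _ with copy-dominated (λ hub↦r2 → contradiction (trans (sym hub↦r0) hub↦r2) λ ())
                                   (proj₂ (⊔ᴿ≡r0 _ _ i↦r0))
    ...   | j , i~j , j↦r2 = j , i~j , foldExcept-r2 a j↦r2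
    foldExcept-isRDF hub↦r0 a i i↦r0 | yes refl with h-rdf (old a) i↦r0
    ...   | old j  , a~j , j↦r2 = j , a~j , foldExcept-r2 a j↦r2
    ...   | copy j , a~j , j↦r2 =
      j , a~j , trans (foldExcept-other a (adjacent⇒≢ G a~j ∘ sym)) (⊔ᴿ≡r2 _ _ (inj₂ j↦r2))

    weight-foldExcept : ∀ a → h (copy a) ≡ r2 → 2 + weight G (foldExcept a) ≤ weight⁰¹ h
    weight-foldExcept a a↦r2 = sumFin-mono-gap N 2 pointwise a gap
      where
      pointwise : ∀ i → val (foldExcept a i) ≤ val (h (old i)) + val (h (copy i))
      pointwise i with i ≟ a
      ... | yes _ = m≤m+n _ _
      ... | no _  = val-⊔ᴿ≤ (h (old i)) (h (copy i))
      gap : 2 + val (foldExcept a a) ≤ val (h (old a)) + val (h (copy a))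
      gap rewrite foldExcept-self a | a↦r2 = ≤-reflexive (+-comm 2 _)

    module _ (hyp : ∀ f → IsγRFun G f → V2HasIsolated G f) {k : ℕ} (k≤ : ∀ f → IsRDF G f → k ≤ weight G f) where

      weight⁰¹-large : h hub ≢ r2 → k < weight⁰¹ h
      weight⁰¹-large hub≢r2 = ≰⇒> λ w≤k →
        let fold-minimal : IsγRFun G fold
            fold-minimal = fold-isRDF , λ g g-rdf → ≤-trans weight-fold≤ (≤-trans w≤k (k≤ g g-rdf))
            a , _ , isolated = hyp fold fold-minimal
            old≢r0 : h (old a) ≢ r0
            old≢r0 a↦r0 = let j , a~j , j↦r2 = old-dominated a↦r0 in subst T (isolated j j↦r2) a~j
            copy≢r0 : h (copy a) ≢ r0
            copy≢r0 a↦r0 = let j , a~j , j↦r2 = copy-dominated hub≢r2 a↦r0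
                           in  subst T (isolated j (⊔ᴿ≡r2 _ _ (inj₁ j↦r2))) a~j
        in 1+n≰n (≤-trans (weight-fold< a old≢r0 copy≢r0) (≤-trans w≤k (k≤ fold fold-isRDF)))

      bound-by-hub : ∀ c → h hub ≡ c → k + 2 ≤ weight⁰¹ h + val c
      bound-by-hub r2 _ = +-monoˡ-≤ 2 (≤-trans (k≤ fold fold-isRDF) weight-fold≤)
      bound-by-hub r1 hub↦r1 =
        subst (_≤ weight⁰¹ h + 1) (sym (+-suc k 1))
              (+-monoˡ-≤ 1 (weight⁰¹-large λ hub↦r2 → contradiction (trans (sym hub↦r1) hub↦r2) λ ()))
      bound-by-hub r0 hub↦r0 with h-rdf hub hub↦r0
      ... | copy a , _ , a↦r2 = begin
        k + 2                        ≡⟨ +-comm k 2 ⟩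
        2 + k                        ≤⟨ +-monoʳ-≤ 2 (k≤ _ (foldExcept-isRDF hub↦r0 a)) ⟩
        2 + weight G (foldExcept a)  ≤⟨ weight-foldExcept a a↦r2 ⟩
        weight⁰¹ h                   ≡⟨ +-identityʳ _ ⟨
        weight⁰¹ h + 0               ∎
        where open ≤-Reasoning

      weightᴹ-lower-bound : k + 2 ≤ weightᴹ h
      weightᴹ-lower-bound = bound-by-hub (h hub) refl

theorem4 : (G : Graph)
         → (∀ f → IsγRFun G f → V2HasIsolated G f)
         → ∀ k → IsγR G k → IsγR (μ G) (k + 2)
theorem4 G hyp k ((f , f-rdf , f-weight) , k≤) =
    (extend G f ∘ view (n G) , isRDF-view G (extend-isRDF G f-rdf) , extension-weight)
  , λ g g-rdf → subst (k + 2 ≤_) (sym (weight-μ G g)) (weightᴹ-lower-bound G (isRDF-embed G g-rdf) hyp k≤)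
  where
  open ≡-Reasoning
  extension-weight : weight (μ G) (extend G f ∘ view (n G)) ≡ k + 2
  extension-weight = begin
    weight (μ G) (extend G f ∘ view (n G)) ≡⟨ weight-view G (extend G f) ⟩
    weightᴹ G (extend G f)                 ≡⟨ weightᴹ-extend G f ⟩
    weight G f + 2                         ≡⟨ cong (_+ 2) f-weight ⟩
    k + 2                                  ∎
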